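{- Let $d$ be a positive square-free integer, $\mathcal{O}_d$ the ring of integers of $\mathbb{Q}(\sqrt{ -d})$, $t\in\mathcal{O}_d$ with $|t|\geq 100$, and $\mu\in\mathcal{O}_d^\times$. Let $(x,y)\in\mathcal{O}_d^2$ satisfy \[ F_t(x,y) = x^4 - t x^3 y - 6 x^2 y^2 + t x y^3 + y^4 = \mu. \] If $\min\{|x|,|y|\}<3$, then $(x,y)$ is of the shape $(\xi,0)$ or $(0,\xi)$ with $\xi$ a root of unity in $\mathcal{O}_d$.
   Context: $|\cdot|$ is the complex absolute value. -}

module Defs where

open import Data.Nat as ℕ using (ℕ; _%_; _/_; _≡ᵇ_)
open import Data.Nat.Divisibility as ℕD using ()
open import Data.Integer as ℤ using (ℤ; +_; _+_; _*_; -_; _-_)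
open import Data.Bool using (if_then_else_)
open import Data.Product using (Σ; _×_; ∃-syntax)
open import Relation.Binary.PropositionalEquality using (_≡_)

SquareFree : ℕ → Set
SquareFree d = ∀ (k : ℕ) → (k ℕ.* k) ℕD.∣ d → k ≡ 1

-- Ring of integers O_d of Q(√-d) (d square-free, positive), with Z-basis {1, ω}:
--   ω = (1 + √-d)/2  if d ≡ 3 (mod 4)   (then ω² = ω - (1+d)/4)
--   ω = √-d          otherwise          (then ω² = -d)
-- Uniformly ω² = s·ω - q.
sω : ℕ → ℤ
sω d = if d % 4 ≡ᵇ 3 then + 1 else + 0

qω : ℕ → ℤ
qω d = if d % 4 ≡ᵇ 3 then + ((d ℕ.+ 1) / 4) else + d

record O (d : ℕ) : Set where
  constructor _+_ω
  field
    re : ℤ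
    im : ℤ
open O public

module _ {d : ℕ} where
  0O : O d
  0O = (+ 0) + (+ 0) ω

  1O : O d
  1O = (+ 1) + (+ 0) ω

  _⊕_ : O d → O d → O d
  (a + b ω) ⊕ (c + e ω) = (a + c) + (b + e) ω

  ⊖_ : O d → O d
  ⊖ (a + b ω) = (- a) + (- b) ω

  _⊝_ : O d → O d → O d
  x ⊝ y = x ⊕ (⊖ y)

  _⊗_ : O d → O d → O d
  (a + b ω) ⊗ (c + e ω) = (a * c - qω d * (b * e)) + (a * e + b * c + sω d * (b * e)) ω

  _^_ : O d → ℕ → O d
  x ^ ℕ.zero = 1O
  x ^ ℕ.suc n = x ⊗ (x ^ n)

  ι : ℤ → O d
  ι n = n + (+ 0) ω

  absSq : O d → ℤ
  absSq (a + b ω) = a * a + sω d * (a * b) + qω d * (b * b)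

  IsUnit : O d → Set
  IsUnit μ = ∃[ ν ] (μ ⊗ ν ≡ 1O)

  IsRootOfUnity : O d → Set
  IsRootOfUnity ξ = ∃[ n ] (ℕ.NonZero n × ξ ^ n ≡ 1O)

  F : O d → O d → O d → O d
  F t x y = ((((x ^ 4) ⊝ (t ⊗ ((x ^ 3) ⊗ y))) ⊝ (ι (+ 6) ⊗ ((x ^ 2) ⊗ (y ^ 2))))
              ⊕ (t ⊗ (x ⊗ (y ^ 3)))) ⊕ (y ^ 4)

{-# OPTIONS --safe #-}
module Submission where

-- Writing u = y² − x², v = xy and w = u + t·v, one has F_t(x, y) = u·w − 4v².
-- The norm N = |·|² is ℕ-valued and multiplicative, and √N satisfies the
-- triangle inequality in both directions.  When 1 ≤ N x ≤ 8 and N y ≥ 1 these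
-- bounds force N(F) ≥ 2: either u = 0, or N(u·w) ≥ 4·N(4v²) — from
-- |w| ≥ |t||v| − |u| while |y| is moderate, from w = y(y + tx) − x² once |y| is
-- large — or y + tx = 0 and N(4v²) dominates N(u·w).  Since N(F) = N μ = 1, one
-- coordinate vanishes and F is the fourth power of the other, which thus has
-- norm 1.  An element of norm 1 is ±1 if its ω-coordinate vanishes; otherwise
-- its trace τ satisfies τ² < 4, and it is a root of X² − τX + 1, a divisor of
-- X³ − 1, X⁴ − 1 or X⁶ − 1.

open import Defs
open import Data.Nat as ℕ using (ℕ)
open import Data.Integer as ℤ using (ℤ; +_)
open import Data.Product using (_×_; ∃-syntax; _,_)
open import Data.Sum using (_⊎_)
open import Relation.Binary.PropositionalEquality using (_≡_)

module SquaredTriangles where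
  open import Data.Nat
  open import Data.Nat.Properties
  open import Data.Nat.Tactic.RingSolver using (solve)
  open import Data.Product using (_,_)
  open import Data.Sum using (inj₁; inj₂)
  open import Data.List using (_∷_; [])
  open import Data.Empty using (⊥-elim)
  open import Relation.Binary.PropositionalEquality
  open import Relation.Nullary using (yes; no)

  private
    variable
      P R Z : ℕ

  square-cancel-≤ : ∀ {m n} → m * m ≤ n * n → m ≤ n
  square-cancel-≤ {m} {n} m²≤n² with m ≤? n
  ... | yes m≤n = m≤n
  ... | no m≰n = ⊥-elim (<⇒≱ (*-mono-< (≰⇒> m≰n) (≰⇒> m≰n)) m²≤n²)

  -- √P, √R and √Z are the sides of a possibly degenerate triangle; in Heron's form
  -- this condition is symmetric and free of square roots.
  record Triangle (P R Z : ℕ) : Set where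
    constructor heron
    field
      heron-inequality : 2 * (P * P + R * R + Z * Z) ≤ (P + R + Z) * (P + R + Z)

  Triangle-sym₁₂ : Triangle P R Z → Triangle R P Z
  Triangle-sym₁₂ {P} {R} {Z} (heron tri) = heron (begin
    2 * (R * R + P * P + Z * Z)  ≡⟨ solve (P ∷ R ∷ Z ∷ []) ⟩
    2 * (P * P + R * R + Z * Z)  ≤⟨ tri ⟩
    (P + R + Z) * (P + R + Z)    ≡⟨ solve (P ∷ R ∷ Z ∷ []) ⟩
    (R + P + Z) * (R + P + Z)    ∎)
    where open ≤-Reasoning

  Triangle-sym₁₃ : Triangle P R Z → Triangle Z R P
  Triangle-sym₁₃ {P} {R} {Z} (heron tri) = heron (begin
    2 * (Z * Z + R * R + P * P)  ≡⟨ solve (P ∷ R ∷ Z ∷ []) ⟩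
    2 * (P * P + R * R + Z * Z)  ≤⟨ tri ⟩
    (P + R + Z) * (P + R + Z)    ≡⟨ solve (P ∷ R ∷ Z ∷ []) ⟩
    (Z + R + P) * (Z + R + P)    ∎)
    where open ≤-Reasoning

  triangle-excess : ∀ k → Triangle P R (P + R + k) → k * k ≤ 4 * (P * R)
  triangle-excess {P} {R} k (heron tri) = +-cancelˡ-≤ _ _ _ (begin
    2 * (P * P + R * R + (P + R) * (P + R)) + 4 * ((P + R) * k) + k * k + k * k
      ≡⟨ solve (P ∷ R ∷ k ∷ []) ⟩
    2 * (P * P + R * R + (P + R + k) * (P + R + k))
      ≤⟨ tri ⟩
    (P + R + (P + R + k)) * (P + R + (P + R + k))
      ≡⟨ solve (P ∷ R ∷ k ∷ []) ⟩
    2 * (P * P + R * R + (P + R) * (P + R)) + 4 * ((P + R) * k) + k * k + 4 * (P * R) ∎)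
    where open ≤-Reasoning

  triangle-upper-bound : ∀ M → Triangle P R Z → P * R ≤ M * M → Z ≤ P + R + 2 * M
  triangle-upper-bound {P} {R} {Z} M tri PR≤M² with ≤-total Z (P + R)
  ... | inj₁ Z≤P+R = ≤-trans Z≤P+R (m≤m+n (P + R) (2 * M))
  ... | inj₂ P+R≤Z with m≤n⇒∃[o]m+o≡n P+R≤Z
  ... | k , refl = +-monoʳ-≤ (P + R) (square-cancel-≤ (begin
    k * k              ≤⟨ triangle-excess k tri ⟩
    4 * (P * R)        ≤⟨ *-monoʳ-≤ 4 PR≤M² ⟩
    4 * (M * M)        ≡⟨ solve (M ∷ []) ⟩
    2 * M * (2 * M)    ∎))
    where open ≤-Reasoning

  triangle-upper : ∀ A B S → P ≤ A * A * S → R ≤ B * B * S → Triangle P R Z → Z ≤ (A + B) * (A + B) * S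
  triangle-upper {P} {R} {Z} A B S P≤ R≤ tri = begin
    Z                              ≤⟨ triangle-upper-bound (A * B * S) tri PR≤ ⟩
    P + R + 2 * (A * B * S)        ≤⟨ +-monoˡ-≤ _ (+-mono-≤ P≤ R≤) ⟩
    A * A * S + B * B * S + 2 * (A * B * S) ≡⟨ solve (A ∷ B ∷ S ∷ []) ⟩
    (A + B) * (A + B) * S          ∎
    where
    open ≤-Reasoning
    PR≤ : P * R ≤ A * B * S * (A * B * S)
    PR≤ = ≤-trans (*-mono-≤ P≤ R≤) (≤-reflexive (solve (A ∷ B ∷ S ∷ [])))

  triangle-lower : ∀ B c S → Triangle P R Z → R ≤ B * B * S → (B + c) * (B + c) * S ≤ P → c * c * S ≤ Z
  triangle-lower {P} {R} {Z} B c S tri R≤ P≥ with c * c * S ≤? Z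
  ... | yes c²S≤Z = c²S≤Z
  ... | no c²S≰Z = ⊥-elim (<⇒≱ P< P≥)
    where
    open ≤-Reasoning
    Z< : Z < c * c * S
    Z< = ≰⇒> c²S≰Z
    ZR≤ : Z * R ≤ c * B * S * (c * B * S)
    ZR≤ = ≤-trans (*-mono-≤ (<⇒≤ Z<) R≤) (≤-reflexive (solve (B ∷ S ∷ c ∷ [])))
    P< : P < (B + c) * (B + c) * S
    P< = begin-strict
      P                                        ≤⟨ triangle-upper-bound (c * B * S) (Triangle-sym₁₃ tri) ZR≤ ⟩
      Z + R + 2 * (c * B * S)                  <⟨ +-monoˡ-< _ (+-mono-<-≤ Z< R≤) ⟩
      c * c * S + B * B * S + 2 * (c * B * S)  ≡⟨ solve (B ∷ S ∷ c ∷ []) ⟩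
      (B + c) * (B + c) * S                    ∎

  triangle-upper₁ : ∀ A B → P ≤ A * A → R ≤ B * B → Triangle P R Z → Z ≤ (A + B) * (A + B)
  triangle-upper₁ A B P≤ R≤ tri = ≤-trans
    (triangle-upper A B 1 (≤-trans P≤ (≤-reflexive (sym (*-identityʳ (A * A)))))
                          (≤-trans R≤ (≤-reflexive (sym (*-identityʳ (B * B))))) tri)
    (≤-reflexive (*-identityʳ ((A + B) * (A + B))))

  triangle-lower₁ : ∀ B c → Triangle P R Z → R ≤ B * B → (B + c) * (B + c) ≤ P → c * c ≤ Z
  triangle-lower₁ B c tri R≤ P≥ = ≤-trans (≤-reflexive (sym (*-identityʳ (c * c))))
    (triangle-lower B c 1 tri (≤-trans R≤ (≤-reflexive (sym (*-identityʳ (B * B)))))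
                              (≤-trans (≤-reflexive (*-identityʳ ((B + c) * (B + c)))) P≥))

module QuarticNormBound where
  open SquaredTriangles
  open import Data.Nat
  open import Data.Nat.Properties
  open import Data.Nat.Tactic.RingSolver using (solve)
  open import Data.Product using (_,_)
  open import Data.List using (_∷_; [])
  open import Relation.Binary.PropositionalEquality
  open import Relation.Nullary using (yes; no)
  open import Relation.Nullary.Decidable using (from-yes)

  [Y+8]²≤6400Y : ∀ {Y} → 1 ≤ Y → Y ≤ 5328 → (Y + 8) * (Y + 8) ≤ 6400 * Y
  [Y+8]²≤6400Y {Y} 1≤Y Y≤5328 = begin
    (Y + 8) * (Y + 8)              ≡⟨ solve (Y ∷ []) ⟩
    Y * Y + 16 * Y + 64 * 1        ≤⟨ +-mono-≤ (+-monoˡ-≤ (16 * Y) (*-monoˡ-≤ Y Y≤5328)) (*-monoʳ-≤ 64 1≤Y) ⟩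
    5328 * Y + 16 * Y + 64 * Y     ≡⟨ solve (Y ∷ []) ⟩
    5408 * Y                       ≤⟨ *-monoˡ-≤ Y (from-yes (5408 ≤? 6400)) ⟩
    6400 * Y                       ∎
    where open ≤-Reasoning

  512[8+k]≤400k² : ∀ {k} → 4 ≤ k → 512 * (8 + k) ≤ 400 * (k * k)
  512[8+k]≤400k² {k} 4≤k = begin
    512 * (8 + k)        ≡⟨ solve (k ∷ []) ⟩
    4096 + 512 * k       ≤⟨ +-monoˡ-≤ (512 * k) (≤-trans (from-yes (4096 ≤? 4352)) (*-monoʳ-≤ 1088 4≤k)) ⟩
    1088 * k + 512 * k   ≡⟨ solve (k ∷ []) ⟩
    400 * (4 * k)        ≤⟨ *-monoʳ-≤ 400 (*-monoˡ-≤ k 4≤k) ⟩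
    400 * (k * k)        ∎
    where open ≤-Reasoning

  64[8+k]≤65k : ∀ {k} → 512 ≤ k → 64 * (8 + k) ≤ 65 * k
  64[8+k]≤65k {k} 512≤k = begin
    64 * (8 + k)     ≡⟨ solve (k ∷ []) ⟩
    512 + 64 * k     ≤⟨ +-monoˡ-≤ (64 * k) 512≤k ⟩
    k + 64 * k       ≡⟨ solve (k ∷ []) ⟩
    65 * k           ∎
    where open ≤-Reasoning

  -- X, Y, T, U, W, E and Fn stand for the norms of x, y, t, u, w, y + tx and F_t(x, y).
  module _ {X Y T U W E Fn : ℕ}
    (1≤X : 1 ≤ X) (X≤8 : X ≤ 8) (1≤Y : 1 ≤ Y) (10⁴≤T : 10000 ≤ T)
    (triU : Triangle (Y * Y) (X * X) U)
    (triW : Triangle U (T * (X * Y)) W)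
    (triW′ : Triangle (Y * E) (X * X) W)
    (triF : Triangle (U * W) (16 * (X * Y * (X * Y))) Fn)
    where

    private
      V : ℕ
      V = X * Y

      X²≤64 : X * X ≤ 8 * 8
      X²≤64 = *-mono-≤ X≤8 X≤8

      1≤V : 1 ≤ V
      1≤V = *-mono-≤ 1≤X 1≤Y

      Y≤V : Y ≤ V
      Y≤V = ≤-trans (≤-reflexive (sym (*-identityˡ Y))) (*-monoˡ-≤ Y 1≤X)

      V≤8Y : V ≤ 8 * Y
      V≤8Y = *-monoˡ-≤ Y X≤8

      10⁴V≤TV : 10000 * V ≤ T * V
      10⁴V≤TV = *-monoˡ-≤ V 10⁴≤T

      open ≤-Reasoning

    U≡0⇒4V²≤Fn : U ≡ 0 → 4 * (V * V) ≤ Fn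
    U≡0⇒4V²≤Fn U≡0 = begin
      4 * (V * V)             ≤⟨ *-monoˡ-≤ (V * V) (from-yes (4 ≤? 16)) ⟩
      16 * (V * V)            ≡⟨ sym (*-identityˡ _) ⟩
      1 * 1 * (16 * (V * V))  ≤⟨ triangle-lower 0 1 _ (Triangle-sym₁₂ triF) (≤-reflexive UW≡0)
                                                  (≤-reflexive (*-identityˡ _)) ⟩
      Fn                      ∎
      where
      UW≡0 : U * W ≡ 0
      UW≡0 = cong (_* W) U≡0

    64V²≤UW⇒4V²≤Fn : 64 * (V * V) ≤ U * W → 4 * (V * V) ≤ Fn
    64V²≤UW⇒4V²≤Fn 64V²≤UW = begin
      4 * (V * V)             ≤⟨ *-monoˡ-≤ (V * V) (from-yes (4 ≤? 16)) ⟩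
      16 * (V * V)            ≡⟨ sym (*-identityˡ _) ⟩
      1 * 1 * (16 * (V * V))  ≤⟨ triangle-lower 1 1 _ triF (≤-reflexive (sym (*-identityˡ _))) 64V²≤UW′ ⟩
      Fn                      ∎
      where
      64V²≤UW′ : (1 + 1) * (1 + 1) * (16 * (V * V)) ≤ U * W
      64V²≤UW′ = ≤-trans (≤-reflexive (sym (*-assoc 4 16 (V * V)))) 64V²≤UW

    Y≤11⇒64V²≤UW : 1 ≤ U → Y ≤ 11 → 64 * (V * V) ≤ U * W
    Y≤11⇒64V²≤UW 1≤U Y≤11 = begin
      64 * (V * V)    ≡⟨ sym (*-assoc 64 V V) ⟩
      64 * V * V      ≤⟨ *-monoˡ-≤ V (*-monoʳ-≤ 64 (*-mono-≤ X≤8 Y≤11)) ⟩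
      5632 * V        ≤⟨ *-monoˡ-≤ V (from-yes (5632 ≤? 6561)) ⟩
      6561 * V        ≡⟨ sym (*-identityˡ _) ⟩
      1 * (6561 * V)  ≤⟨ *-mono-≤ 1≤U W≥ ⟩
      U * W           ∎
      where
      U≤ : U ≤ 19 * 19 * V
      U≤ = ≤-trans (triangle-upper₁ 11 8 (*-mono-≤ Y≤11 Y≤11) X²≤64 triU) (*-monoʳ-≤ 361 1≤V)
      W≥ : 81 * 81 * V ≤ W
      W≥ = triangle-lower 19 81 V (Triangle-sym₁₂ triW) U≤ 10⁴V≤TV

    12≤Y≤5328⇒64V²≤UW : 12 ≤ Y → Y ≤ 5328 → 64 * (V * V) ≤ U * W
    12≤Y≤5328⇒64V²≤UW 12≤Y Y≤5328 with m≤n⇒∃[o]m+o≡n (≤-trans (from-yes (8 ≤? 12)) 12≤Y)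
    ... | k , refl = begin
      64 * (V * V)                ≡⟨ sym (*-assoc 64 V V) ⟩
      64 * V * V                  ≤⟨ *-monoˡ-≤ V (*-monoʳ-≤ 64 V≤8Y) ⟩
      64 * (8 * (8 + k)) * V      ≡⟨ cong (_* V) (sym (*-assoc 64 8 (8 + k))) ⟩
      512 * (8 + k) * V           ≤⟨ *-monoˡ-≤ V (512[8+k]≤400k² (∸-monoˡ-≤ 8 12≤Y)) ⟩
      400 * (k * k) * V           ≡⟨ cong (_* V) (*-comm 400 (k * k)) ⟩
      k * k * 400 * V             ≡⟨ *-assoc (k * k) 400 V ⟩
      k * k * (400 * V)           ≤⟨ *-mono-≤ (triangle-lower₁ 8 k triU X²≤64 ≤-refl) W≥ ⟩
      U * W                       ∎
      where
      U≤ : U ≤ 4 * 4 * (400 * V)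
      U≤ = begin
        U                          ≤⟨ triangle-upper₁ (8 + k) 8 ≤-refl X²≤64 triU ⟩
        (8 + k + 8) * (8 + k + 8)  ≤⟨ [Y+8]²≤6400Y 1≤Y Y≤5328 ⟩
        6400 * (8 + k)             ≤⟨ *-monoʳ-≤ 6400 Y≤V ⟩
        6400 * V                   ≡⟨ *-assoc 16 400 V ⟩
        4 * 4 * (400 * V)          ∎
      W≥ : 400 * V ≤ W
      W≥ = ≤-trans (≤-reflexive (sym (*-identityˡ (400 * V))))
             (triangle-lower 4 1 (400 * V) (Triangle-sym₁₂ triW) U≤
               (≤-trans (≤-reflexive (sym (*-assoc 25 400 V))) 10⁴V≤TV))

    5329≤Y⇒64V²≤UW : 5329 ≤ Y → 1 ≤ E → 64 * (V * V) ≤ U * W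
    5329≤Y⇒64V²≤UW 5329≤Y 1≤E with m≤n⇒∃[o]m+o≡n (≤-trans (from-yes (8 ≤? 5329)) 5329≤Y)
    ... | k , refl = begin
      64 * (X * (8 + k) * (X * (8 + k)))          ≡⟨ solve (X ∷ k ∷ []) ⟩
      8 * (X * (8 + k)) * (8 * (X * (8 + k)))    ≤⟨ *-mono-≤ 8V≤ 8V≤ ⟩
      64 * (8 + k) * (64 * (8 + k))              ≤⟨ *-mono-≤ 64Y≤ 64Y≤ ⟩
      65 * k * (65 * k)                          ≡⟨ solve (k ∷ []) ⟩
      k * k * (65 * 65)                          ≤⟨ *-mono-≤ (triangle-lower₁ 8 k triU X²≤64 ≤-refl) W≥ ⟩
      U * W                                      ∎
      where
      8V≤ : 8 * V ≤ 64 * (8 + k)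
      8V≤ = ≤-trans (*-monoʳ-≤ 8 V≤8Y) (≤-reflexive (sym (*-assoc 8 8 (8 + k))))
      64Y≤ : 64 * (8 + k) ≤ 65 * k
      64Y≤ = 64[8+k]≤65k (≤-trans (from-yes (512 ≤? 5321)) (∸-monoˡ-≤ 8 5329≤Y))
      W≥ : 65 * 65 ≤ W
      W≥ = triangle-lower₁ 8 65 triW′ X²≤64
             (≤-trans 5329≤Y (≤-trans (≤-reflexive (sym (*-identityʳ (8 + k)))) (*-monoʳ-≤ (8 + k) 1≤E)))

    E≡0⇒4V²≤Fn : X ≤ Y → E ≡ 0 → 4 * (V * V) ≤ Fn
    E≡0⇒4V²≤Fn X≤Y E≡0 = begin
      4 * (X * Y * (X * Y))          ≡⟨ solve (X ∷ Y ∷ []) ⟩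
      2 * (X * Y) * (2 * (X * Y))    ≤⟨ triangle-lower₁ ((Y + X) * X) (2 * V) (Triangle-sym₁₂ triF) UW≤ B+2V≤ ⟩
      Fn                             ∎
      where
      UW≤ : U * W ≤ (Y + X) * X * ((Y + X) * X)
      UW≤ = begin
        U * W                              ≤⟨ *-mono-≤ (triangle-upper₁ Y X ≤-refl ≤-refl triU)
                                                       (triangle-upper₁ 0 X YE≤0 ≤-refl triW′) ⟩
        (Y + X) * (Y + X) * (X * X)        ≡⟨ solve (X ∷ Y ∷ []) ⟩
        (Y + X) * X * ((Y + X) * X)        ∎
        where
        YE≤0 : Y * E ≤ 0 * 0
        YE≤0 = ≤-reflexive (trans (cong (Y *_) E≡0) (*-zeroʳ Y))
      B+2V≤ : ((Y + X) * X + 2 * V) * ((Y + X) * X + 2 * V) ≤ 16 * (V * V)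
      B+2V≤ = begin
        ((Y + X) * X + 2 * (X * Y)) * ((Y + X) * X + 2 * (X * Y))  ≤⟨ *-mono-≤ B+2V≤4V B+2V≤4V ⟩
        4 * (X * Y) * (4 * (X * Y))                                ≡⟨ solve (X ∷ Y ∷ []) ⟩
        16 * (X * Y * (X * Y))                                     ∎
        where
        B+2V≤4V : (Y + X) * X + 2 * (X * Y) ≤ 4 * (X * Y)
        B+2V≤4V = begin
          (Y + X) * X + 2 * (X * Y)        ≡⟨ solve (X ∷ Y ∷ []) ⟩
          X * Y + X * X + 2 * (X * Y)      ≤⟨ +-monoˡ-≤ (2 * (X * Y)) (+-monoʳ-≤ (X * Y) (*-monoʳ-≤ X X≤Y)) ⟩
          X * Y + X * Y + 2 * (X * Y)      ≡⟨ solve (X ∷ Y ∷ []) ⟩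
          4 * (X * Y)                      ∎

    private
      from-4V² : 4 * (V * V) ≤ Fn → 1 < Fn
      from-4V² = ≤-trans (≤-trans (from-yes (2 ≤? 4)) (*-monoʳ-≤ 4 (*-mono-≤ 1≤V 1≤V)))

    1<Fn : 1 < Fn
    1<Fn with U ≟ 0
    ... | yes U≡0 = from-4V² (U≡0⇒4V²≤Fn U≡0)
    ... | no U≢0 with Y ≤? 11
    ...   | yes Y≤11 = from-4V² (64V²≤UW⇒4V²≤Fn (Y≤11⇒64V²≤UW (n≢0⇒n>0 U≢0) Y≤11))
    ...   | no Y≰11 with Y ≤? 5328
    ...     | yes Y≤5328 = from-4V² (64V²≤UW⇒4V²≤Fn (12≤Y≤5328⇒64V²≤UW (≰⇒> Y≰11) Y≤5328))
    ...     | no Y≰5328 with E ≟ 0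
    ...       | yes E≡0 =
      from-4V² (E≡0⇒4V²≤Fn (≤-trans X≤8 (≤-trans (from-yes (8 ≤? 5329)) (≰⇒> Y≰5328))) E≡0)
    ...       | no E≢0 = from-4V² (64V²≤UW⇒4V²≤Fn (5329≤Y⇒64V²≤UW (≰⇒> Y≰5328) (n≢0⇒n>0 E≢0)))

open SquaredTriangles using (Triangle; heron)
open QuarticNormBound using (1<Fn)

open import Data.Nat using (_≤_; _<_; s≤s; z≤n)
import Data.Nat.Properties as ℕ
open import Data.Nat.DivMod using (m%n≤m; m≥n⇒m/n>0)
import Data.Nat.Tactic.RingSolver as ℕ-Solver
open import Data.Integer using (-[1+_]; _+_; _*_; -_; _-_; ∣_∣)
import Data.Integer.Properties as ℤ
open import Data.Integer.Tactic.RingSolver using (solve-∀)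
open import Data.Sum using (inj₁; inj₂; [_,_]′; swap)
open import Data.Empty using (⊥-elim)
open import Data.Bool using (true; false)
import Data.Bool as Bool
open import Data.Unit using (tt)
open import Data.Vec using (Vec; lookup; _∷_; [])
open import Data.Fin using (zero; suc)
open import Data.Maybe using (Maybe; just; nothing)
open import Level using (0ℓ)
open import Relation.Binary.PropositionalEquality
  using (refl; sym; trans; cong; cong₂; subst; isEquivalence; module ≡-Reasoning)
open import Relation.Nullary using (Dec; yes; no)
open import Algebra.Bundles using (CommutativeRing)
open import Algebra.Structures using (IsCommutativeRing)
open import Algebra.Solver.Ring.AlmostCommutativeRing
  using (fromCommutativeRing; _-Raw-AlmostCommutative⟶_)
import Algebra.Solver.Ring as Solver

private
  ⊗-assoc-re : ∀ s q a b c e f g →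
    (a * c - q * (b * e)) * f - q * ((a * e + b * c + s * (b * e)) * g)
      ≡ a * (c * f - q * (e * g)) - q * (b * (c * g + e * f + s * (e * g)))
  ⊗-assoc-re = solve-∀

  ⊗-assoc-im : ∀ s q a b c e f g →
    (a * c - q * (b * e)) * g + (a * e + b * c + s * (b * e)) * f + s * ((a * e + b * c + s * (b * e)) * g)
      ≡ a * (c * g + e * f + s * (e * g)) + b * (c * f - q * (e * g)) + s * (b * (c * g + e * f + s * (e * g)))
  ⊗-assoc-im = solve-∀

  ⊗-comm-re : ∀ q a b c e → a * c - q * (b * e) ≡ c * a - q * (e * b)
  ⊗-comm-re = solve-∀

  ⊗-comm-im : ∀ s a b c e → a * e + b * c + s * (b * e) ≡ c * b + e * a + s * (e * b)
  ⊗-comm-im = solve-∀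

  ⊗-identityˡ-re : ∀ q a b → + 1 * a - q * (+ 0 * b) ≡ a
  ⊗-identityˡ-re = solve-∀

  ⊗-identityˡ-im : ∀ s a b → + 1 * b + + 0 * a + s * (+ 0 * b) ≡ b
  ⊗-identityˡ-im = solve-∀

  ⊗-distribʳ-re : ∀ q a b c e f g →
    (c + f) * a - q * ((e + g) * b) ≡ (c * a - q * (e * b)) + (f * a - q * (g * b))
  ⊗-distribʳ-re = solve-∀

  ⊗-distribʳ-im : ∀ s a b c e f g →
    (c + f) * b + (e + g) * a + s * ((e + g) * b) ≡ (c * b + e * a + s * (e * b)) + (f * b + g * a + s * (g * b))
  ⊗-distribʳ-im = solve-∀

  ι-⊗-re : ∀ q a c → a * c ≡ a * c - q * (+ 0 * + 0)
  ι-⊗-re = solve-∀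

  ι-⊗-im : ∀ s a c → + 0 ≡ a * + 0 + + 0 * c + s * (+ 0 * + 0)
  ι-⊗-im = solve-∀

module _ {d : ℕ} where
  private
    s = sω d
    q = qω d

  ⊕-assoc : (x y z : O d) → (x ⊕ y) ⊕ z ≡ x ⊕ (y ⊕ z)
  ⊕-assoc (a + b ω) (c + e ω) (f + g ω) = cong₂ _+_ω (ℤ.+-assoc a c f) (ℤ.+-assoc b e g)

  ⊕-comm : (x y : O d) → x ⊕ y ≡ y ⊕ x
  ⊕-comm (a + b ω) (c + e ω) = cong₂ _+_ω (ℤ.+-comm a c) (ℤ.+-comm b e)

  ⊕-identityˡ : (x : O d) → 0O ⊕ x ≡ x
  ⊕-identityˡ (a + b ω) = cong₂ _+_ω (ℤ.+-identityˡ a) (ℤ.+-identityˡ b)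

  ⊕-identityʳ : (x : O d) → x ⊕ 0O ≡ x
  ⊕-identityʳ (a + b ω) = cong₂ _+_ω (ℤ.+-identityʳ a) (ℤ.+-identityʳ b)

  ⊖-inverseˡ : (x : O d) → (⊖ x) ⊕ x ≡ 0O
  ⊖-inverseˡ (a + b ω) = cong₂ _+_ω (ℤ.+-inverseˡ a) (ℤ.+-inverseˡ b)

  ⊖-inverseʳ : (x : O d) → x ⊕ (⊖ x) ≡ 0O
  ⊖-inverseʳ (a + b ω) = cong₂ _+_ω (ℤ.+-inverseʳ a) (ℤ.+-inverseʳ b)

  ⊗-assoc : (x y z : O d) → (x ⊗ y) ⊗ z ≡ x ⊗ (y ⊗ z)
  ⊗-assoc (a + b ω) (c + e ω) (f + g ω) =
    cong₂ _+_ω (⊗-assoc-re s q a b c e f g) (⊗-assoc-im s q a b c e f g)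

  ⊗-comm : (x y : O d) → x ⊗ y ≡ y ⊗ x
  ⊗-comm (a + b ω) (c + e ω) = cong₂ _+_ω (⊗-comm-re q a b c e) (⊗-comm-im s a b c e)

  ⊗-identityˡ : (x : O d) → 1O ⊗ x ≡ x
  ⊗-identityˡ (a + b ω) = cong₂ _+_ω (⊗-identityˡ-re q a b) (⊗-identityˡ-im s a b)

  ⊗-identityʳ : (x : O d) → x ⊗ 1O ≡ x
  ⊗-identityʳ x = trans (⊗-comm x 1O) (⊗-identityˡ x)

  ⊗-distribʳ : (x y z : O d) → (y ⊕ z) ⊗ x ≡ (y ⊗ x) ⊕ (z ⊗ x)
  ⊗-distribʳ (a + b ω) (c + e ω) (f + g ω) =
    cong₂ _+_ω (⊗-distribʳ-re q a b c e f g) (⊗-distribʳ-im s a b c e f g)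

  ⊗-distribˡ : (x y z : O d) → x ⊗ (y ⊕ z) ≡ (x ⊗ y) ⊕ (x ⊗ z)
  ⊗-distribˡ x y z = trans (⊗-comm x (y ⊕ z)) (trans (⊗-distribʳ x y z) (cong₂ _⊕_ (⊗-comm y x) (⊗-comm z x)))

  ι-⊗ : ∀ m n → ι {d} (m * n) ≡ ι m ⊗ ι n
  ι-⊗ m n = cong₂ _+_ω (ι-⊗-re q m n) (ι-⊗-im s m n)

  -- The solver works over opaque copies of the operations: its normal forms are then
  -- compared syntactically, instead of by unfolding ⊗ on open terms (which is very slow).
  opaque
    _⊕ᵒ_ _⊗ᵒ_ : O d → O d → O d
    _⊕ᵒ_ = _⊕_
    _⊗ᵒ_ = _⊗_

    ⊖ᵒ_ : O d → O d
    ⊖ᵒ_ = ⊖_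

  opaque
    unfolding _⊕ᵒ_

    isCommutativeRing : IsCommutativeRing _≡_ _⊕ᵒ_ _⊗ᵒ_ ⊖ᵒ_ 0O 1O
    isCommutativeRing = record
      { isRing = record
        { +-isAbelianGroup = record
          { isGroup = record
            { isMonoid = record
              { isSemigroup = record
                { isMagma = record { isEquivalence = isEquivalence ; ∙-cong = cong₂ _⊕_ }
                ; assoc = ⊕-assoc }
              ; identity = ⊕-identityˡ , ⊕-identityʳ }
            ; inverse = ⊖-inverseˡ , ⊖-inverseʳ
            ; ⁻¹-cong = cong ⊖_ }
          ; comm = ⊕-comm }
        ; *-cong = cong₂ _⊗_
        ; *-assoc = ⊗-assoc
        ; *-identity = ⊗-identityˡ , ⊗-identityʳ
        ; distrib = ⊗-distribˡ , ⊗-distribʳ }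
      ; *-comm = ⊗-comm }

    ι-⊕ᵒ : ∀ m n → ι {d} (m + n) ≡ ι m ⊕ᵒ ι n
    ι-⊕ᵒ m n = refl

    ι-⊗ᵒ : ∀ m n → ι {d} (m * n) ≡ ι m ⊗ᵒ ι n
    ι-⊗ᵒ = ι-⊗

    ι-⊖ᵒ : ∀ m → ι {d} (- m) ≡ ⊖ᵒ ι m
    ι-⊖ᵒ m = refl

commutativeRing : ℕ → CommutativeRing 0ℓ 0ℓ
commutativeRing d = record { isCommutativeRing = isCommutativeRing {d} }

ι-homomorphism : {d : ℕ} → ℤ.+-*-rawRing -Raw-AlmostCommutative⟶ fromCommutativeRing (commutativeRing d)
ι-homomorphism = record
  { ⟦_⟧ = ι ; +-homo = ι-⊕ᵒ ; *-homo = ι-⊗ᵒ ; -‿homo = ι-⊖ᵒ ; 0-homo = refl ; 1-homo = refl }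

ι-≟ : {d : ℕ} (m n : ℤ) → Maybe (ι {d} m ≡ ι n)
ι-≟ m n with m ℤ.≟ n
... | yes m≡n = just (cong ι m≡n)
... | no _ = nothing

module O-Solver {d : ℕ} where
  open Solver ℤ.+-*-rawRing (fromCommutativeRing (commutativeRing d)) ι-homomorphism ι-≟ public

  eval : ∀ {n} → Polynomial n → Vec (O d) n → O d
  eval (op [+] p₁ p₂) ρ = eval p₁ ρ ⊕ eval p₂ ρ
  eval (op [*] p₁ p₂) ρ = eval p₁ ρ ⊗ eval p₂ ρ
  eval (con c) ρ = ι c
  eval (var i) ρ = lookup ρ i
  eval (p :^ n) ρ = eval p ρ ^ n
  eval (:- p) ρ = ⊖ eval p ρ

  opaque
    unfolding _⊕ᵒ_

    ⟦⟧≡eval : ∀ {n} (p : Polynomial n) (ρ : Vec (O d) n) → ⟦ p ⟧ ρ ≡ eval p ρ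
    ⟦⟧≡eval (op [+] p₁ p₂) ρ = cong₂ _⊕_ (⟦⟧≡eval p₁ ρ) (⟦⟧≡eval p₂ ρ)
    ⟦⟧≡eval (op [*] p₁ p₂) ρ = cong₂ _⊗_ (⟦⟧≡eval p₁ ρ) (⟦⟧≡eval p₂ ρ)
    ⟦⟧≡eval (con c) ρ = refl
    ⟦⟧≡eval (var i) ρ = refl
    ⟦⟧≡eval (p :^ n) ρ = trans (⟦⟧-^ n (⟦ p ⟧ ρ)) (cong (_^ n) (⟦⟧≡eval p ρ))
      where
      ⟦⟧-^ : ∀ n x → ⟦ var zero :^ n ⟧ (x ∷ []) ≡ x ^ n
      ⟦⟧-^ ℕ.zero x = refl
      ⟦⟧-^ (ℕ.suc n) x = cong (x ⊗_) (⟦⟧-^ n x)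
    ⟦⟧≡eval (:- p) ρ = cong ⊖_ (⟦⟧≡eval p ρ)

  polynomial-identity : ∀ {n} (p₁ p₂ : Polynomial n) (ρ : Vec (O d) n) →
    ⟦ p₁ ⟧↓ ρ ≡ ⟦ p₂ ⟧↓ ρ → eval p₁ ρ ≡ eval p₂ ρ
  polynomial-identity p₁ p₂ ρ h = trans (sym (⟦⟧≡eval p₁ ρ)) (trans (prove ρ p₁ p₂ h) (⟦⟧≡eval p₂ ρ))

module _ {d : ℕ} where
  open O-Solver {d}

  private
    T X Y : Polynomial 3
    T = var zero
    X = var (suc zero)
    Y = var (suc (suc zero))

    Fₚ : Polynomial 3 → Polynomial 3 → Polynomial 3 → Polynomial 3
    Fₚ t x y = ((((x :^ 4) :- (t :* ((x :^ 3) :* y))) :- (con (+ 6) :* ((x :^ 2) :* (y :^ 2))))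
                 :+ (t :* (x :* (y :^ 3)))) :+ (y :^ 4)

  F-swap : (t x y : O d) → F t x y ≡ F (⊖ t) y x
  F-swap t x y = polynomial-identity (Fₚ T X Y) (Fₚ (:- T) Y X) (t ∷ x ∷ y ∷ []) refl

  F-zeroˡ : (t y : O d) → F t 0O y ≡ (y ⊗ y) ⊗ (y ⊗ y)
  F-zeroˡ t y = polynomial-identity (Fₚ T (con (+ 0)) Y) ((Y :* Y) :* (Y :* Y)) (t ∷ 0O ∷ y ∷ []) refl

  module Factorisation (t x y : O d) where
    u v w e : O d
    u = (y ⊗ y) ⊝ (x ⊗ x)
    v = x ⊗ y
    w = u ⊕ (t ⊗ v)
    e = y ⊕ (t ⊗ x)

    private
      Uₚ : Polynomial 3
      Uₚ = (Y :* Y) :- (X :* X)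

    F≡uw-4v² : F t x y ≡ (u ⊗ w) ⊝ (ι (+ 4) ⊗ (v ⊗ v))
    F≡uw-4v² = polynomial-identity (Fₚ T X Y)
      ((Uₚ :* (Uₚ :+ (T :* (X :* Y)))) :- (con (+ 4) :* ((X :* Y) :* (X :* Y)))) (t ∷ x ∷ y ∷ []) refl

    w≡ye-x² : w ≡ (y ⊗ e) ⊝ (x ⊗ x)
    w≡ye-x² = polynomial-identity (Uₚ :+ (T :* (X :* Y))) ((Y :* (Y :+ (T :* X))) :- (X :* X)) (t ∷ x ∷ y ∷ []) refl

module _ {d : ℕ} where
  open O-Solver {d}
  open ≡-Reasoning

  private
    X : Polynomial 1
    X = var zero

    -- Xⁿ = 1 + (X² − cX + 1)·Q, checked by the solver, makes every root of X² − cX + 1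
    -- an n-th root of unity.
    xⁿ≡1 : ∀ n c (Q : Polynomial 1) (ξ : O d) →
      ⟦ X :^ n ⟧↓ (ξ ∷ []) ≡ ⟦ con (+ 1) :+ (((X :* X) :- ((con c :* X) :- con (+ 1))) :* Q) ⟧↓ (ξ ∷ []) →
      ξ ⊗ ξ ≡ (ι c ⊗ ξ) ⊝ 1O → ξ ^ n ≡ 1O
    xⁿ≡1 n c Q ξ normal-forms ξ²≡cξ-1 = begin
      ξ ^ n
        ≡⟨ polynomial-identity (X :^ n) (con (+ 1) :+ (((X :* X) :- Rₚ) :* Q)) (ξ ∷ []) normal-forms ⟩
      1O ⊕ (((ξ ⊗ ξ) ⊝ r) ⊗ q)
        ≡⟨ cong (λ z → 1O ⊕ ((z ⊝ r) ⊗ q)) ξ²≡cξ-1 ⟩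
      1O ⊕ ((r ⊝ r) ⊗ q)
        ≡⟨ polynomial-identity (con (+ 1) :+ ((R :- R) :* Q′)) (con (+ 1)) (r ∷ q ∷ []) refl ⟩
      1O
        ∎
      where
      Rₚ = (con c :* X) :- con (+ 1)
      r = (ι c ⊗ ξ) ⊝ 1O
      q = eval Q (ξ ∷ [])
      R Q′ : Polynomial 2
      R = var zero
      Q′ = var (suc zero)

  x²≡cx-1⇒IsRootOfUnity : ∀ {c} (ξ : O d) → c ≡ + 0 ⊎ c ≡ + 1 ⊎ c ≡ -[1+ 0 ] →
    ξ ⊗ ξ ≡ (ι c ⊗ ξ) ⊝ 1O → IsRootOfUnity ξ
  x²≡cx-1⇒IsRootOfUnity ξ (inj₁ refl) h =
    4 , _ , xⁿ≡1 4 (+ 0) ((X :* X) :- con (+ 1)) ξ refl h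
  x²≡cx-1⇒IsRootOfUnity ξ (inj₂ (inj₁ refl)) h =
    6 , _ , xⁿ≡1 6 (+ 1) ((X :^ 4) :+ (X :^ 3) :- X :- con (+ 1)) ξ refl h
  x²≡cx-1⇒IsRootOfUnity ξ (inj₂ (inj₂ refl)) h =
    3 , _ , xⁿ≡1 3 -[1+ 0 ] (X :- con (+ 1)) ξ refl h

  ι²≡1⇒IsRootOfUnity : (a : ℤ) → a * a ≡ + 1 → IsRootOfUnity (ι {d} a)
  ι²≡1⇒IsRootOfUnity a a²≡1 = 2 , _ , (begin
    ι a ^ 2      ≡⟨ polynomial-identity (X :^ 2) (X :* X) (ι a ∷ []) refl ⟩
    ι a ⊗ ι a    ≡⟨ sym (ι-⊗ a a) ⟩
    ι (a * a)    ≡⟨ cong ι a²≡1 ⟩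
    1O           ∎)

N : {d : ℕ} → O d → ℕ
N x = ∣ absSq x ∣

trace : {d : ℕ} → O d → ℤ
trace {d} x = + 2 * re x + sω d * im x

private
  absSq-⊗-identity : ∀ s q a b c e →
    let norm : ℤ → ℤ → ℤ
        norm x y = x * x + s * (x * y) + q * (y * y)
    in norm (a * c - q * (b * e)) (a * e + b * c + s * (b * e)) ≡ norm a b * norm c e
  absSq-⊗-identity = solve-∀

  absSq-⊖-identity : ∀ s q a b →
    - a * - a + s * (- a * - b) + q * (- b * - b) ≡ a * a + s * (a * b) + q * (b * b)
  absSq-⊖-identity = solve-∀

  absSq-ι-identity : ∀ s q a → a * a + s * (a * + 0) + q * (+ 0 * + 0) ≡ a * a
  absSq-ι-identity = solve-∀

  four-absSq-identity : ∀ s q a b →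
    + 4 * (a * a + s * (a * b) + q * (b * b))
      ≡ (+ 2 * a + s * b) * (+ 2 * a + s * b) + (+ 4 * q - s * s) * (b * b)
  four-absSq-identity = solve-∀

  heron-identity : ∀ s q a b c e →
    let norm : ℤ → ℤ → ℤ
        norm x y = x * x + s * (x * y) + q * (y * y)
        P = norm a b
        R = norm c e
        Z = norm (a + c) (b + e)
        m = a * e - b * c
    in (P + R + Z) * (P + R + Z) ≡ + 2 * (P * P + R * R + Z * Z) + (+ 4 * q - s * s) * (m * m)
  heron-identity = solve-∀

  cayley-hamilton-re : ∀ s q a b →
    a * a - q * (b * b) ≡ ((+ 2 * a + s * b) * a - q * (+ 0 * b)) + - (a * a + s * (a * b) + q * (b * b))
  cayley-hamilton-re = solve-∀

  cayley-hamilton-im : ∀ s q a b →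
    a * b + b * a + s * (b * b) ≡ ((+ 2 * a + s * b) * b + + 0 * a + s * (+ 0 * b)) + - + 0
  cayley-hamilton-im = solve-∀

square≡+∣i∣² : ∀ i → i * i ≡ + (∣ i ∣ ℕ.* ∣ i ∣)
square≡+∣i∣² (+ n) = sym (ℤ.pos-* n n)
square≡+∣i∣² -[1+ n ] = refl

square≡0⇒≡0 : ∀ m → m ℕ.* m ≡ 0 → m ≡ 0
square≡0⇒≡0 ℕ.zero _ = refl

∣i∣≤1⇒i∈0,1,-1 : ∀ i → ∣ i ∣ ≤ 1 → i ≡ + 0 ⊎ i ≡ + 1 ⊎ i ≡ -[1+ 0 ]
∣i∣≤1⇒i∈0,1,-1 (+ 0) _ = inj₁ refl
∣i∣≤1⇒i∈0,1,-1 (+ 1) _ = inj₂ (inj₁ refl)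
∣i∣≤1⇒i∈0,1,-1 -[1+ 0 ] _ = inj₂ (inj₂ refl)
∣i∣≤1⇒i∈0,1,-1 (+ ℕ.suc (ℕ.suc _)) (s≤s ())
∣i∣≤1⇒i∈0,1,-1 -[1+ ℕ.suc _ ] (s≤s ())

triangle-from-ℤ : ∀ {p r z P R Z} K → p ≡ + P → r ≡ + R → z ≡ + Z →
  (p + r + z) * (p + r + z) ≡ + 2 * (p * p + r * r + z * z) + + K →
  Triangle P R Z
triangle-from-ℤ {P = P} {R} {Z} K refl refl refl eq =
  heron (ℕ.≤-trans (ℕ.m≤m+n _ K) (ℕ.≤-reflexive (sym (ℤ.+-injective (trans (trans lhs eq) (sym rhs))))))
  where
  S = P ℕ.* P ℕ.+ R ℕ.* R ℕ.+ Z ℕ.* Z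
  +sum : + (P ℕ.+ R ℕ.+ Z) ≡ + P + + R + + Z
  +sum = trans (ℤ.pos-+ (P ℕ.+ R) Z) (cong (_+ + Z) (ℤ.pos-+ P R))
  lhs : + ((P ℕ.+ R ℕ.+ Z) ℕ.* (P ℕ.+ R ℕ.+ Z)) ≡ (+ P + + R + + Z) * (+ P + + R + + Z)
  lhs = trans (ℤ.pos-* (P ℕ.+ R ℕ.+ Z) (P ℕ.+ R ℕ.+ Z)) (cong₂ _*_ +sum +sum)
  rhs : + (2 ℕ.* S ℕ.+ K) ≡ + 2 * (+ P * + P + + R * + R + + Z * + Z) + + K
  rhs = trans (ℤ.pos-+ (2 ℕ.* S) K) (cong (_+ + K) (trans (ℤ.pos-* 2 S) (cong (+ 2 *_)
          (trans (ℤ.pos-+ (P ℕ.* P ℕ.+ R ℕ.* R) (Z ℕ.* Z))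
                 (cong₂ _+_ (trans (ℤ.pos-+ (P ℕ.* P) (R ℕ.* R)) (cong₂ _+_ (ℤ.pos-* P P) (ℤ.pos-* R R)))
                            (ℤ.pos-* Z Z))))))

module _ {d : ℕ} where
  cayley-hamilton : (x : O d) → x ⊗ x ≡ (ι (trace x) ⊗ x) ⊝ ι (absSq x)
  cayley-hamilton (a + b ω) =
    cong₂ _+_ω (cayley-hamilton-re (sω d) (qω d) a b) (cayley-hamilton-im (sω d) (qω d) a b)

  N-⊗ : (x y : O d) → N (x ⊗ y) ≡ N x ℕ.* N y
  N-⊗ x@(a + b ω) y@(c + e ω) =
    trans (cong ∣_∣ (absSq-⊗-identity (sω d) (qω d) a b c e)) (ℤ.abs-* (absSq x) (absSq y))

  N-⊖ : (x : O d) → N (⊖ x) ≡ N x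
  N-⊖ (a + b ω) = cong ∣_∣ (absSq-⊖-identity (sω d) (qω d) a b)

  N-ι : (a : ℤ) → N (ι {d} a) ≡ ∣ a ∣ ℕ.* ∣ a ∣
  N-ι a = trans (cong ∣_∣ (absSq-ι-identity (sω d) (qω d) a)) (ℤ.abs-* a a)

  im≡0⇒≡ι : (x : O d) → im x ≡ + 0 → x ≡ ι (re x)
  im≡0⇒≡ι (a + b ω) b≡0 = cong (a +_ω) b≡0

  N⁴≡1⇒N≡1 : (z : O d) → N ((z ⊗ z) ⊗ (z ⊗ z)) ≡ 1 → N z ≡ 1
  N⁴≡1⇒N≡1 z N≡1 = ℕ.m*n≡1⇒m≡1 _ _ (ℕ.m*n≡1⇒m≡1 _ _
    (trans (sym (trans (N-⊗ (z ⊗ z) (z ⊗ z)) (cong₂ ℕ._*_ (N-⊗ z z) (N-⊗ z z)))) N≡1))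

  IsUnit⇒N≡1 : (μ : O d) → IsUnit μ → N μ ≡ 1
  IsUnit⇒N≡1 μ (ν , μν≡1) =
    ℕ.m*n≡1⇒m≡1 (N μ) (N ν) (trans (sym (N-⊗ μ ν)) (trans (cong N μν≡1) (N-ι (+ 1))))

module _ {d D : ℕ} (Δ≡D : + 4 * qω d - sω d * sω d ≡ + D) where

  four-absSq : (x : O d) →
    + 4 * absSq x ≡ + (∣ trace x ∣ ℕ.* ∣ trace x ∣ ℕ.+ D ℕ.* (∣ im x ∣ ℕ.* ∣ im x ∣))
  four-absSq x@(a + b ω) = begin
    + 4 * absSq x
      ≡⟨ four-absSq-identity (sω d) (qω d) a b ⟩
    trace x * trace x + (+ 4 * qω d - sω d * sω d) * (b * b)
      ≡⟨ cong₂ _+_ (square≡+∣i∣² (trace x)) (cong₂ _*_ Δ≡D (square≡+∣i∣² b)) ⟩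
    + (∣ trace x ∣ ℕ.* ∣ trace x ∣) + + D * + (∣ b ∣ ℕ.* ∣ b ∣)
      ≡⟨ cong (_+_ (+ (∣ trace x ∣ ℕ.* ∣ trace x ∣))) (sym (ℤ.pos-* D (∣ b ∣ ℕ.* ∣ b ∣))) ⟩
    + (∣ trace x ∣ ℕ.* ∣ trace x ∣) + + (D ℕ.* (∣ b ∣ ℕ.* ∣ b ∣))
      ≡⟨ sym (ℤ.pos-+ (∣ trace x ∣ ℕ.* ∣ trace x ∣) (D ℕ.* (∣ b ∣ ℕ.* ∣ b ∣))) ⟩
    + (∣ trace x ∣ ℕ.* ∣ trace x ∣ ℕ.+ D ℕ.* (∣ b ∣ ℕ.* ∣ b ∣))
      ∎
    where open ≡-Reasoning

  absSq≡+N : (x : O d) → absSq x ≡ + N x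
  absSq≡+N x = nonnegative (absSq x) (four-absSq x)
    where
    nonnegative : ∀ i {n} → + 4 * i ≡ + n → i ≡ + ∣ i ∣
    nonnegative (+ _) _ = refl

  N-⊕ : (x y : O d) → Triangle (N x) (N y) (N (x ⊕ y))
  N-⊕ x@(a + b ω) y@(c + e ω) =
    triangle-from-ℤ (D ℕ.* (∣ m ∣ ℕ.* ∣ m ∣)) (absSq≡+N x) (absSq≡+N y) (absSq≡+N (x ⊕ y))
      (trans (heron-identity (sω d) (qω d) a b c e)
             (cong (_+_ (+ 2 * (absSq x * absSq x + absSq y * absSq y + absSq (x ⊕ y) * absSq (x ⊕ y))))
                   (trans (cong₂ _*_ Δ≡D (square≡+∣i∣² m)) (sym (ℤ.pos-* D (∣ m ∣ ℕ.* ∣ m ∣))))))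
    where m = a * e - b * c

  module _ (1≤D : 1 ≤ D) where

    ∣trace∣²+∣im∣²≤4N : (x : O d) → ∣ trace x ∣ ℕ.* ∣ trace x ∣ ℕ.+ ∣ im x ∣ ℕ.* ∣ im x ∣ ≤ 4 ℕ.* N x
    ∣trace∣²+∣im∣²≤4N x = ℕ.≤-trans
      (ℕ.+-monoʳ-≤ _ (ℕ.m≤n*m _ D {{ℕ.>-nonZero 1≤D}}))
      (ℕ.≤-reflexive (ℤ.+-injective (sym (trans (ℤ.pos-* 4 (N x))
        (trans (cong (+ 4 *_) (sym (absSq≡+N x))) (four-absSq x))))))

    N≡0⇒≡0 : (x : O d) → N x ≡ 0 → x ≡ 0O
    N≡0⇒≡0 x N≡0 = trans x≡ι (cong ι (ℤ.∣i∣≡0⇒i≡0 (square≡0⇒≡0 _ ∣a∣²≡0)))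
      where
      ∣b∣²≡0 : ∣ im x ∣ ℕ.* ∣ im x ∣ ≡ 0
      ∣b∣²≡0 = ℕ.n≤0⇒n≡0 (ℕ.≤-trans (ℕ.m≤n+m _ _)
                 (ℕ.≤-trans (∣trace∣²+∣im∣²≤4N x) (ℕ.≤-reflexive (cong (4 ℕ.*_) N≡0))))
      x≡ι : x ≡ ι (re x)
      x≡ι = im≡0⇒≡ι x (ℤ.∣i∣≡0⇒i≡0 (square≡0⇒≡0 _ ∣b∣²≡0))
      ∣a∣²≡0 : ∣ re x ∣ ℕ.* ∣ re x ∣ ≡ 0
      ∣a∣²≡0 = trans (sym (N-ι {d} (re x))) (trans (cong N (sym x≡ι)) N≡0)

    N≡1⇒IsRootOfUnity : (ξ : O d) → N ξ ≡ 1 → IsRootOfUnity ξ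
    N≡1⇒IsRootOfUnity ξ N≡1 with im ξ ℤ.≟ + 0
    ... | yes b≡0 =
      subst IsRootOfUnity (sym ξ≡ι) (ι²≡1⇒IsRootOfUnity a (trans (square≡+∣i∣² a) (cong +_ ∣a∣²≡1)))
      where
      a = re ξ
      ξ≡ι : ξ ≡ ι a
      ξ≡ι = im≡0⇒≡ι ξ b≡0
      ∣a∣²≡1 : ∣ a ∣ ℕ.* ∣ a ∣ ≡ 1
      ∣a∣²≡1 = trans (sym (N-ι {d} a)) (trans (cong N (sym ξ≡ι)) N≡1)
    ... | no b≢0 = x²≡cx-1⇒IsRootOfUnity ξ (∣i∣≤1⇒i∈0,1,-1 (trace ξ) ∣trace∣≤1) ξ²≡τξ-1
      where
      ∣trace∣≤1 : ∣ trace ξ ∣ ≤ 1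
      ∣trace∣≤1 with ∣ trace ξ ∣ ℕ.≤? 1
      ... | yes ∣τ∣≤1 = ∣τ∣≤1
      ... | no ∣τ∣≰1 =
        ⊥-elim (ℕ.<⇒≱ (ℕ.+-mono-≤ (ℕ.*-mono-≤ (ℕ.≰⇒> ∣τ∣≰1) (ℕ.≰⇒> ∣τ∣≰1)) 1≤∣b∣²) ≤4)
        where
        1≤∣b∣² : 1 ≤ ∣ im ξ ∣ ℕ.* ∣ im ξ ∣
        1≤∣b∣² = ℕ.n≢0⇒n>0 (λ ∣b∣²≡0 → b≢0 (ℤ.∣i∣≡0⇒i≡0 (square≡0⇒≡0 _ ∣b∣²≡0)))
        ≤4 : ∣ trace ξ ∣ ℕ.* ∣ trace ξ ∣ ℕ.+ ∣ im ξ ∣ ℕ.* ∣ im ξ ∣ ≤ 4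
        ≤4 = ℕ.≤-trans (∣trace∣²+∣im∣²≤4N ξ) (ℕ.≤-reflexive (cong (4 ℕ.*_) N≡1))
      ξ²≡τξ-1 : ξ ⊗ ξ ≡ (ι (trace ξ) ⊗ ξ) ⊝ 1O
      ξ²≡τξ-1 = trans (cayley-hamilton ξ)
        (cong (λ n → (ι (trace ξ) ⊗ ξ) ⊝ ι n) (trans (absSq≡+N ξ) (cong +_ N≡1)))

    N-F>1 : (t x y : O d) → 10000 ≤ N t → 1 ≤ N x → N x ≤ 8 → 1 ≤ N y → 1 < N (F t x y)
    N-F>1 t x y 10⁴≤Nt 1≤Nx Nx≤8 1≤Ny = 1<Fn 1≤Nx Nx≤8 1≤Ny 10⁴≤Nt triU triW triW′ triF
      where
      open Factorisation t x y
      triangle : (a b : O d) {P R : ℕ} → N a ≡ P → N b ≡ R → Triangle P R (N (a ⊕ b))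
      triangle a b refl refl = N-⊕ a b
      N-x² : N (⊖ (x ⊗ x)) ≡ N x ℕ.* N x
      N-x² = trans (N-⊖ (x ⊗ x)) (N-⊗ x x)
      N-4v² : N (⊖ (ι (+ 4) ⊗ (v ⊗ v))) ≡ 16 ℕ.* (N x ℕ.* N y ℕ.* (N x ℕ.* N y))
      N-4v² = trans (N-⊖ (ι (+ 4) ⊗ (v ⊗ v))) (trans (N-⊗ (ι (+ 4)) (v ⊗ v))
                (cong₂ ℕ._*_ (N-ι {d} (+ 4)) (trans (N-⊗ v v) (cong₂ ℕ._*_ (N-⊗ x y) (N-⊗ x y)))))
      triU : Triangle (N y ℕ.* N y) (N x ℕ.* N x) (N u)
      triU = triangle (y ⊗ y) (⊖ (x ⊗ x)) (N-⊗ y y) N-x²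
      triW : Triangle (N u) (N t ℕ.* (N x ℕ.* N y)) (N w)
      triW = triangle u (t ⊗ v) refl (trans (N-⊗ t v) (cong (N t ℕ.*_) (N-⊗ x y)))
      triW′ : Triangle (N y ℕ.* N e) (N x ℕ.* N x) (N w)
      triW′ = subst (Triangle (N y ℕ.* N e) (N x ℕ.* N x)) (cong N (sym w≡ye-x²))
                (triangle (y ⊗ e) (⊖ (x ⊗ x)) (N-⊗ y e) N-x²)
      triF : Triangle (N u ℕ.* N w) (16 ℕ.* (N x ℕ.* N y ℕ.* (N x ℕ.* N y))) (N (F t x y))
      triF = subst (Triangle (N u ℕ.* N w) (16 ℕ.* (N x ℕ.* N y ℕ.* (N x ℕ.* N y)))) (cong N (sym F≡uw-4v²))
               (triangle (u ⊗ w) (⊖ (ι (+ 4) ⊗ (v ⊗ v))) (N-⊗ u w) N-4v²)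

    small-solutions : (t x y : O d) → 10000 ≤ N t → N x ≤ 8 → N (F t x y) ≡ 1 →
      (x ≡ 0O × N y ≡ 1) ⊎ (y ≡ 0O × N x ≡ 1)
    small-solutions t x y 10⁴≤Nt Nx≤8 NF≡1 = cases (N x ℕ.≟ 0) (N y ℕ.≟ 0)
      where
      cases : Dec (N x ≡ 0) → Dec (N y ≡ 0) → (x ≡ 0O × N y ≡ 1) ⊎ (y ≡ 0O × N x ≡ 1)
      cases (yes Nx≡0) _ = inj₁ (x≡0 , N⁴≡1⇒N≡1 y
          (trans (cong N (sym (F-zeroˡ t y))) (subst (λ z → N (F t z y) ≡ 1) x≡0 NF≡1)))
        where
        x≡0 : x ≡ 0O
        x≡0 = N≡0⇒≡0 x Nx≡0
      cases (no _) (yes Ny≡0) = inj₂ (y≡0 , N⁴≡1⇒N≡1 x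
          (trans (cong N (sym (trans (F-swap t x 0O) (F-zeroˡ (⊖ t) x)))) (subst (λ z → N (F t x z) ≡ 1) y≡0 NF≡1)))
        where
        y≡0 : y ≡ 0O
        y≡0 = N≡0⇒≡0 y Ny≡0
      cases (no Nx≢0) (no Ny≢0) =
        ⊥-elim (ℕ.<-irrefl (sym NF≡1) (N-F>1 t x y 10⁴≤Nt (ℕ.n≢0⇒n>0 Nx≢0) Nx≤8 (ℕ.n≢0⇒n>0 Ny≢0)))

    small-coordinate-solutions : (t μ x y : O d) → + 10000 ℤ.≤ absSq t → IsUnit μ → F t x y ≡ μ →
      (absSq x ℤ.< + 9 ⊎ absSq y ℤ.< + 9) →
      (∃[ ξ ] (IsRootOfUnity ξ × x ≡ ξ × y ≡ 0O)) ⊎ (∃[ ξ ] (IsRootOfUnity ξ × x ≡ 0O × y ≡ ξ))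
    small-coordinate-solutions t μ x y 10⁴≤|t|² μ-unit F≡μ = [ from-x , from-y ]′
      where
      NF≡1 : N (F t x y) ≡ 1
      NF≡1 = trans (cong N F≡μ) (IsUnit⇒N≡1 μ μ-unit)
      10⁴≤Nt : 10000 ≤ N t
      10⁴≤Nt = ℤ.drop‿+≤+ (subst (+ 10000 ℤ.≤_) (absSq≡+N t) 10⁴≤|t|²)
      ≤8 : (z : O d) → absSq z ℤ.< + 9 → N z ≤ 8
      ≤8 z |z|²<9 = ℕ.≤-pred (ℤ.drop‿+<+ (subst (ℤ._< + 9) (absSq≡+N z) |z|²<9))
      conclude : (x ≡ 0O × N y ≡ 1) ⊎ (y ≡ 0O × N x ≡ 1) →
        (∃[ ξ ] (IsRootOfUnity ξ × x ≡ ξ × y ≡ 0O)) ⊎ (∃[ ξ ] (IsRootOfUnity ξ × x ≡ 0O × y ≡ ξ))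
      conclude (inj₁ (x≡0 , Ny≡1)) = inj₂ (y , N≡1⇒IsRootOfUnity y Ny≡1 , x≡0 , refl)
      conclude (inj₂ (y≡0 , Nx≡1)) = inj₁ (x , N≡1⇒IsRootOfUnity x Nx≡1 , refl , y≡0)
      from-x = λ |x|²<9 → conclude (small-solutions t x y 10⁴≤Nt (≤8 x |x|²<9) NF≡1)
      from-y = λ |y|²<9 → conclude (swap (small-solutions (⊖ t) y x
        (subst (10000 ≤_) (sym (N-⊖ t)) 10⁴≤Nt) (≤8 y |y|²<9) (trans (cong N (sym (F-swap t x y))) NF≡1)))

1≤[d+1]/4 : ∀ d → d ℕ.% 4 ≡ 3 → 1 ≤ (d ℕ.+ 1) ℕ./ 4
1≤[d+1]/4 d d%4≡3 = m≥n⇒m/n>0 (ℕ.≤-trans (s≤s 3≤d) (ℕ.≤-reflexive (ℕ.+-comm 1 d)))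
  where
  3≤d : 3 ≤ d
  3≤d = ℕ.≤-trans (ℕ.≤-reflexive (sym d%4≡3)) (m%n≤m d 4)

positive-discriminant : (d : ℕ) → 1 ≤ d → ∃[ D ] (1 ≤ D × + 4 * qω d - sω d * sω d ≡ + D)
positive-discriminant d 1≤d with d ℕ.% 4 ℕ.≡ᵇ 3 in d%4≡ᵇ3
... | false = 4 ℕ.* d , ℕ.≤-trans 1≤d (ℕ.m≤n*m d 4) , trans (ℤ.+-identityʳ _) (sym (ℤ.pos-* 4 d))
... | true with (d ℕ.+ 1) ℕ./ 4 | 1≤[d+1]/4 d (ℕ.≡ᵇ⇒≡ _ _ (subst Bool.T (sym d%4≡ᵇ3) tt))
...   | ℕ.suc k | _ = 3 ℕ.+ 4 ℕ.* k , s≤s z≤n , cong +_ (k+3[1+k]≡3+4k k)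
  where
  k+3[1+k]≡3+4k : ∀ k → k ℕ.+ 3 ℕ.* ℕ.suc k ≡ 3 ℕ.+ 4 ℕ.* k
  k+3[1+k]≡3+4k = ℕ-Solver.solve-∀

lemma4p1 : (d : ℕ) → 1 ℕ.≤ d → SquareFree d →
    (t μ x y : O d) → + 10000 ℤ.≤ absSq t → IsUnit μ →
    F t x y ≡ μ →
    (absSq x ℤ.< + 9 ⊎ absSq y ℤ.< + 9) →
    (∃[ ξ ] (IsRootOfUnity ξ × x ≡ ξ × y ≡ 0O)) ⊎ (∃[ ξ ] (IsRootOfUnity ξ × x ≡ 0O × y ≡ ξ))
lemma4p1 d 1≤d _ with positive-discriminant d 1≤d
... | D , 1≤D , Δ≡D = small-coordinate-solutions Δ≡D 1≤D
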